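{- Let $B_J\in\mathbb{R}^{n\times n}$ and $q\in\mathbb{R}^n$. Let $Q$ be the $n\times n$ diagonal matrix whose $i$-th diagonal entry is $\operatorname{sign}(q_i)$, and let $\bar B_J=B_JQ$ and $\bar q=Qq$. If $(\bar B_J^\top,\bar q)$ is a Kaykobad pair, then $(B_J,q)$ is a refining pair. If $(-\bar B_J^\top,\bar q)$ is a Kaykobad pair, then $(B_J,q)$ is a relaxing pair.
   Context: A pair $(M,\nu)$ with $M=(\mu_{ij})\in\mathbb{R}^{n\times n}$, $\nu\in\mathbb{R}^n$ is a Kaykobad pair if all entries of $M$ are nonnegative, its diagonal entries are positive, all entries of $\nu$ are positive, and $\nu_i>\sum_{j\ne i}\mu_{ij}\,\nu_j/\mu_{jj}$ for all $i\le n$. $(M,\nu)$ is a refining pair if $M$ is invertible and $(M^\top)^{ -1}\nu$ has nonnegative entries; it is a relaxing pair if $M$ is invertible and $-(M^\top)^{ -1}\nu$ has nonnegative entries. -}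

module Defs where

open import Level using (0ℓ)
open import Data.Nat using (ℕ; zero; suc)
open import Data.Fin using (Fin; zero; suc; _≟_)
open import Data.Sum using (_⊎_)
open import Data.Product using (Σ; _×_)
open import Relation.Nullary using (¬_; yes; no)
open import Relation.Binary.Core using (Rel)
open import Relation.Binary.Definitions using (tri<; tri≈; tri>)
open import Relation.Binary.Structures using (IsStrictTotalOrder)
open import Relation.Binary.PropositionalEquality using (_≡_; _≢_)
open import Algebra.Core using (Op₁; Op₂)
open import Algebra.Structures using (IsCommutativeRing)

-- An ordered field (with propositional equality).  The real numbers are
-- one; the paper's statement is made for ℝ, and we state it for every
-- ordered field.
record OrderedField : Set₁ where
  infixl 6 _+_
  infixl 7 _*_
  infix  4 _<_
  field
    Carrier : Set
    _+_ _*_ : Op₂ Carrier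
    -_      : Op₁ Carrier
    0# 1#   : Carrier
    _⁻¹     : Op₁ Carrier
    _<_     : Rel Carrier 0ℓ
    isCommutativeRing   : IsCommutativeRing _≡_ _+_ _*_ -_ 0# 1#
    0≢1                 : 0# ≢ 1#
    ⁻¹-inverse          : ∀ x → x ≢ 0# → x * (x ⁻¹) ≡ 1#
    isStrictTotalOrder  : IsStrictTotalOrder _≡_ _<_
    +-monoˡ-<           : ∀ {x y} z → x < y → x + z < y + z
    *-pos               : ∀ {x y} → 0# < x → 0# < y → 0# < x * y

  infix 4 _≤_
  _≤_ : Rel Carrier 0ℓ
  x ≤ y = x < y ⊎ x ≡ y

  open IsStrictTotalOrder isStrictTotalOrder using (compare)

  sign : Carrier → Carrier
  sign x with compare 0# x
  ... | tri< _ _ _ = 1#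
  ... | tri≈ _ _ _ = 0#
  ... | tri> _ _ _ = - 1#

module Matrices (F : OrderedField) where
  open OrderedField F public

  Vector : ℕ → Set
  Vector n = Fin n → Carrier

  Matrix : ℕ → Set
  Matrix n = Fin n → Fin n → Carrier

  sum : ∀ {n} → (Fin n → Carrier) → Carrier
  sum {zero}  f = 0#
  sum {suc n} f = f zero + sum (λ i → f (suc i))

  _ᵀ : ∀ {n} → Matrix n → Matrix n
  (M ᵀ) i j = M j i

  neg : ∀ {n} → Matrix n → Matrix n
  neg M i j = - (M i j)

  _·_ : ∀ {n} → Matrix n → Matrix n → Matrix n
  (A · B) i j = sum (λ k → A i k * B k j)

  _·ᵥ_ : ∀ {n} → Matrix n → Vector n → Vector n
  (A ·ᵥ v) i = sum (λ k → A i k * v k)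

  I : ∀ {n} → Matrix n
  I i j with i ≟ j
  ... | yes _ = 1#
  ... | no  _ = 0#

  diag : ∀ {n} → Vector n → Matrix n
  diag v i j with i ≟ j
  ... | yes _ = v i
  ... | no  _ = 0#

  IsInverse : ∀ {n} → Matrix n → Matrix n → Set
  IsInverse M N = (∀ i j → (M · N) i j ≡ I i j) × (∀ i j → (N · M) i j ≡ I i j)

  KaykobadPair : ∀ {n} → Matrix n → Vector n → Set
  KaykobadPair {n} M ν =
    (∀ i j → 0# ≤ M i j) ×
    (∀ i → 0# < M i i) ×
    (∀ i → 0# < ν i) ×
    (∀ i → sum (λ j → offDiag i j) < ν i)
    where
    offDiag : Fin n → Fin n → Carrier
    offDiag i j with j ≟ i
    ... | yes _ = 0#
    ... | no  _ = M i j * ν j * (M j j ⁻¹)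

  -- refining pair: M invertible and (Mᵀ)⁻¹ ν ≥ 0
  -- (M is invertible iff Mᵀ is; we quantify over the inverse N of Mᵀ,
  --  which is unique when it exists)
  RefiningPair : ∀ {n} → Matrix n → Vector n → Set
  RefiningPair M ν = Σ _ λ N → IsInverse (M ᵀ) N × (∀ i → 0# ≤ (N ·ᵥ ν) i)

  RelaxingPair : ∀ {n} → Matrix n → Vector n → Set
  RelaxingPair M ν = Σ _ λ N → IsInverse (M ᵀ) N × (∀ i → 0# ≤ - ((N ·ᵥ ν) i))

-- Put M = B̄ᵀ and ν = q̄. The Kaykobad condition says that M is strictly diagonally
-- dominant for the weights w_j = ν_j / M_jj. Weighted dominance survives one step
-- of Gaussian elimination (the Schur complement of the pivot is dominant for the
-- remaining weights), so induction on the size yields a two-sided inverse N of M.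
-- The solution y = N ν of M y = ν is nonnegative by a maximum principle for
-- t_j = y_j / w_j: if min t < 0, the rows where t is smallest and largest give
-- 1 < min t + max t < 1 (or 1 ≤ min t < 0 when max t ≤ 0). Finally ν > 0 forces every
-- sign σ_i to be ±1, so Bᵀ = Q M and (Bᵀ)⁻¹ q = N Q q = N ν. The relaxing case is
-- the same argument for −M, with Bᵀ = (−Q)(−M).
module Submission where

open import Defs
open import Level using (0ℓ)
open import Data.Nat as ℕ using (ℕ; zero; suc)
open import Data.Fin using (Fin; zero; suc; _≟_)
open import Data.Fin.Properties using (suc-injective)
open import Data.Product using (Σ; _×_; _,_; proj₁; proj₂)
open import Data.Sum using (_⊎_; inj₁; inj₂)
open import Data.Empty using (⊥-elim)
open import Function using (_∘′_)
open import Data.Maybe using (Maybe; just; nothing)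
open import Data.List using (allFin)
import Data.List.Extrema
open import Data.List.Relation.Unary.All using (lookup)
open import Data.List.Membership.Propositional.Properties using (∈-allFin)
open import Relation.Nullary using (¬_; yes; no)
open import Relation.Binary.Definitions using (tri<; tri≈; tri>)
open import Relation.Binary.Structures using (IsStrictTotalOrder)
open import Relation.Binary.Bundles using (StrictPartialOrder; TotalOrder)
import Relation.Binary.Properties.StrictTotalOrder as StrictTotalOrderProperties
import Relation.Binary.Reasoning.StrictPartialOrder
open import Relation.Binary.PropositionalEquality
open import Algebra.Bundles using (CommutativeRing; RawRing)
import Algebra.Solver.Ring.AlmostCommutativeRing as ACR
import Algebra.Solver.Ring
import Algebra.Properties.Ring
import Algebra.Properties.AbelianGroup
import Algebra.Properties.CommutativeSemigroup
import Algebra.Properties.Semiring.Mult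

-- Algebra.Solver.Ring proves identities by comparing normal forms with refl, so
-- the coefficients must compute: integers are pairs (a , b) standing for a − b,
-- kept normalised with min a b ≡ 0.
module RingSolver (F : OrderedField) where
  open OrderedField F

  commutativeRing : CommutativeRing 0ℓ 0ℓ
  commutativeRing = record { isCommutativeRing = isCommutativeRing }

  open CommutativeRing commutativeRing
    using (+-comm; distribˡ; distribʳ; +-identityˡ; +-identityʳ; -‿inverseʳ; ring; semiring; +-abelianGroup; +-commutativeSemigroup)
  open Algebra.Properties.Ring ring using (-‿distribˡ-*; -‿distribʳ-*; -‿involutive)
  open Algebra.Properties.AbelianGroup +-abelianGroup using (⁻¹-∙-comm) renaming (ε⁻¹≈ε to -0#≡0#)
  open Algebra.Properties.CommutativeSemigroup +-commutativeSemigroup using (interchange)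
  open Algebra.Properties.Semiring.Mult semiring using (×-homo-+; ×1-homo-*) renaming (_×_ to _×ᵣ_)
  open ≡-Reasoning

  ℤ² : Set
  ℤ² = ℕ × ℕ

  normalise : ℕ → ℕ → ℤ²
  normalise zero    b       = 0 , b
  normalise (suc a) zero    = suc a , 0
  normalise (suc a) (suc b) = normalise a b

  coefficients : RawRing 0ℓ 0ℓ
  coefficients = record
    { Carrier = ℤ²
    ; _≈_     = _≡_
    ; _+_     = λ { (a , b) (c , d) → normalise (a ℕ.+ c) (b ℕ.+ d) }
    ; _*_     = λ { (a , b) (c , d) → normalise (a ℕ.* c ℕ.+ b ℕ.* d) (a ℕ.* d ℕ.+ b ℕ.* c) }
    ; -_      = λ { (a , b) → b , a }
    ; 0#      = 0 , 0
    ; 1#      = 1 , 0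
    }

  fromℕ : ℕ → Carrier
  fromℕ n = n ×ᵣ 1#

  ⟦_⟧ : ℤ² → Carrier
  ⟦ a , b ⟧ = fromℕ a + - fromℕ b

  -‿+ : ∀ x y → - (x + y) ≡ - x + - y
  -‿+ x y = sym (⁻¹-∙-comm x y)

  ⟦normalise⟧ : ∀ a b → ⟦ normalise a b ⟧ ≡ fromℕ a + - fromℕ b
  ⟦normalise⟧ zero    b       = refl
  ⟦normalise⟧ (suc a) zero    = refl
  ⟦normalise⟧ (suc a) (suc b) = begin
    ⟦ normalise a b ⟧                         ≡⟨ ⟦normalise⟧ a b ⟩
    fromℕ a + - fromℕ b                       ≡⟨ +-identityˡ _ ⟨
    0# + (fromℕ a + - fromℕ b)                ≡⟨ cong (_+ (fromℕ a + - fromℕ b)) (-‿inverseʳ 1#) ⟨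
    (1# + - 1#) + (fromℕ a + - fromℕ b)       ≡⟨ interchange 1# (- 1#) (fromℕ a) (- fromℕ b) ⟩
    (1# + fromℕ a) + (- 1# + - fromℕ b)       ≡⟨ cong ((1# + fromℕ a) +_) (-‿+ 1# (fromℕ b)) ⟨
    (1# + fromℕ a) + - (1# + fromℕ b)         ∎

  ⟦⟧-+ : ∀ x y → ⟦ RawRing._+_ coefficients x y ⟧ ≡ ⟦ x ⟧ + ⟦ y ⟧
  ⟦⟧-+ (a , b) (c , d) = begin
    ⟦ normalise (a ℕ.+ c) (b ℕ.+ d) ⟧                    ≡⟨ ⟦normalise⟧ (a ℕ.+ c) (b ℕ.+ d) ⟩
    fromℕ (a ℕ.+ c) + - fromℕ (b ℕ.+ d)                  ≡⟨ cong₂ (λ u v → u + - v) (×-homo-+ 1# a c) (×-homo-+ 1# b d) ⟩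
    (fromℕ a + fromℕ c) + - (fromℕ b + fromℕ d)          ≡⟨ cong ((fromℕ a + fromℕ c) +_) (-‿+ (fromℕ b) (fromℕ d)) ⟩
    (fromℕ a + fromℕ c) + (- fromℕ b + - fromℕ d)        ≡⟨ interchange (fromℕ a) (fromℕ c) (- fromℕ b) (- fromℕ d) ⟩
    (fromℕ a + - fromℕ b) + (fromℕ c + - fromℕ d)        ∎

  ⟦⟧-‿ : ∀ x → ⟦ RawRing.-_ coefficients x ⟧ ≡ - ⟦ x ⟧
  ⟦⟧-‿ (a , b) = begin
    fromℕ b + - fromℕ a          ≡⟨ +-comm _ _ ⟩
    - fromℕ a + fromℕ b          ≡⟨ cong (- fromℕ a +_) (-‿involutive (fromℕ b)) ⟨
    - fromℕ a + - - fromℕ b      ≡⟨ -‿+ (fromℕ a) (- fromℕ b) ⟨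
    - (fromℕ a + - fromℕ b)      ∎

  difference-* : ∀ A B C D → (A + - B) * (C + - D) ≡ (A * C + B * D) + - (A * D + B * C)
  difference-* A B C D = begin
    (A + - B) * (C + - D)                              ≡⟨ distribʳ (C + - D) A (- B) ⟩
    A * (C + - D) + - B * (C + - D)                    ≡⟨ cong₂ _+_ (distribˡ A C (- D)) (distribˡ (- B) C (- D)) ⟩
    (A * C + A * - D) + (- B * C + - B * - D)          ≡⟨ cong₂ _+_ (cong (A * C +_) (-‿distribʳ-* A D))
                                                                    (cong₂ _+_ (-‿distribˡ-* B C) minus-minus) ⟨
    (A * C + - (A * D)) + (- (B * C) + B * D)          ≡⟨ interchange (A * C) (- (A * D)) (- (B * C)) (B * D) ⟩
    (A * C + - (B * C)) + (- (A * D) + B * D)          ≡⟨ cong ((A * C + - (B * C)) +_) (+-comm (- (A * D)) (B * D)) ⟩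
    (A * C + - (B * C)) + (B * D + - (A * D))          ≡⟨ interchange (A * C) (- (B * C)) (B * D) (- (A * D)) ⟩
    (A * C + B * D) + (- (B * C) + - (A * D))          ≡⟨ cong ((A * C + B * D) +_) (+-comm _ _) ⟩
    (A * C + B * D) + (- (A * D) + - (B * C))          ≡⟨ cong ((A * C + B * D) +_) (-‿+ (A * D) (B * C)) ⟨
    (A * C + B * D) + - (A * D + B * C)                ∎
    where
    minus-minus : B * D ≡ - B * - D
    minus-minus = trans (sym (-‿involutive (B * D))) (trans (cong -_ (-‿distribʳ-* B D)) (-‿distribˡ-* B (- D)))

  ⟦⟧-* : ∀ x y → ⟦ RawRing._*_ coefficients x y ⟧ ≡ ⟦ x ⟧ * ⟦ y ⟧
  ⟦⟧-* (a , b) (c , d) = begin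
    ⟦ normalise (a ℕ.* c ℕ.+ b ℕ.* d) (a ℕ.* d ℕ.+ b ℕ.* c) ⟧
      ≡⟨ ⟦normalise⟧ (a ℕ.* c ℕ.+ b ℕ.* d) (a ℕ.* d ℕ.+ b ℕ.* c) ⟩
    fromℕ (a ℕ.* c ℕ.+ b ℕ.* d) + - fromℕ (a ℕ.* d ℕ.+ b ℕ.* c)
      ≡⟨ cong₂ (λ u v → u + - v) (fromℕ-+-* a c b d) (fromℕ-+-* a d b c) ⟩
    (fromℕ a * fromℕ c + fromℕ b * fromℕ d) + - (fromℕ a * fromℕ d + fromℕ b * fromℕ c)
      ≡⟨ difference-* (fromℕ a) (fromℕ b) (fromℕ c) (fromℕ d) ⟨
    ⟦ a , b ⟧ * ⟦ c , d ⟧ ∎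
    where
    fromℕ-+-* : ∀ a c b d → fromℕ (a ℕ.* c ℕ.+ b ℕ.* d) ≡ fromℕ a * fromℕ c + fromℕ b * fromℕ d
    fromℕ-+-* a c b d = trans (×-homo-+ 1# (a ℕ.* c) (b ℕ.* d)) (cong₂ _+_ (×1-homo-* a c) (×1-homo-* b d))

  homomorphism : coefficients ACR.-Raw-AlmostCommutative⟶ ACR.fromCommutativeRing commutativeRing
  homomorphism = record
    { ⟦_⟧    = ⟦_⟧
    ; +-homo = ⟦⟧-+
    ; *-homo = ⟦⟧-*
    ; -‿homo = ⟦⟧-‿
    ; 0-homo = -‿inverseʳ 0#
    ; 1-homo = trans (cong (1# + 0# +_) -0#≡0#) (trans (+-identityʳ _) (+-identityʳ 1#))
    }

  ⟦⟧-≟ : ∀ x y → Maybe (⟦ x ⟧ ≡ ⟦ y ⟧)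
  ⟦⟧-≟ (a , b) (c , d) with a ℕ.≟ c | b ℕ.≟ d
  ... | yes refl | yes refl = just refl
  ... | _        | _        = nothing

  open Algebra.Solver.Ring coefficients (ACR.fromCommutativeRing commutativeRing) homomorphism ⟦⟧-≟
    public using (solve; _:=_; _:+_; _:*_; :-_)

module OrderedFieldProperties (F : OrderedField) where
  open OrderedField F
  open RingSolver F public using (commutativeRing; solve; _:=_; _:+_; _:*_; :-_; -‿+)
  open CommutativeRing commutativeRing public
    using (+-comm; +-assoc; *-comm; *-assoc; distribˡ; distribʳ; +-identityˡ; +-identityʳ;
           *-identityˡ; *-identityʳ; -‿inverseˡ; -‿inverseʳ; zeroˡ; zeroʳ; ring; +-abelianGroup; +-commutativeSemigroup)
  open Algebra.Properties.Ring ring public using (-‿distribˡ-*; -‿distribʳ-*; -‿involutive)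
  open Algebra.Properties.AbelianGroup +-abelianGroup public using () renaming (ε⁻¹≈ε to -0#≡0#)
  open Algebra.Properties.CommutativeSemigroup +-commutativeSemigroup public using (interchange)
  open IsStrictTotalOrder isStrictTotalOrder public using (compare; irrefl; <-resp-≈) renaming (trans to <-trans)
  import Relation.Binary.Construct.StrictToNonStrict _≡_ _<_ as NonStrict

  strictPartialOrder : StrictPartialOrder 0ℓ 0ℓ 0ℓ
  strictPartialOrder = record { isStrictPartialOrder = IsStrictTotalOrder.isStrictPartialOrder isStrictTotalOrder }

  module ≤-Reasoning = Relation.Binary.Reasoning.StrictPartialOrder strictPartialOrder

  -‿*-‿ : ∀ x y → - x * - y ≡ x * y
  -‿*-‿ = solve 2 (λ x y → :- x :* :- y := x :* y) refl

  ≤-refl : ∀ {x} → x ≤ x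
  ≤-refl = inj₂ refl

  ≤-trans : ∀ {x y z} → x ≤ y → y ≤ z → x ≤ z
  ≤-trans = NonStrict.trans isEquivalence <-resp-≈ <-trans

  <-≤-trans : ∀ {x y z} → x < y → y ≤ z → x < z
  <-≤-trans = NonStrict.<-≤-trans <-trans (proj₁ <-resp-≈)

  ≤-<-trans : ∀ {x y z} → x ≤ y → y < z → x < z
  ≤-<-trans = NonStrict.≤-<-trans sym <-trans (proj₂ <-resp-≈)

  <-irrefl : ∀ {x} → ¬ (x < x)
  <-irrefl = irrefl refl

  ≤⇒≯ : ∀ {x y} → x ≤ y → ¬ (y < x)
  ≤⇒≯ x≤y y<x = <-irrefl (≤-<-trans x≤y y<x)

  ≮⇒≥ : ∀ {x y} → ¬ (x < y) → y ≤ x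
  ≮⇒≥ {x} {y} x≮y with compare x y
  ... | tri< x<y _ _   = ⊥-elim (x≮y x<y)
  ... | tri≈ _ x≡y _   = inj₂ (sym x≡y)
  ... | tri> _ _ y<x   = inj₁ y<x

  +-monoʳ-< : ∀ {x y} z → x < y → z + x < z + y
  +-monoʳ-< {x} {y} z x<y = subst₂ _<_ (+-comm x z) (+-comm y z) (+-monoˡ-< z x<y)

  +-monoˡ-≤ : ∀ {x y} z → x ≤ y → x + z ≤ y + z
  +-monoˡ-≤ z (inj₁ x<y)  = inj₁ (+-monoˡ-< z x<y)
  +-monoˡ-≤ z (inj₂ refl) = ≤-refl

  +-monoʳ-≤ : ∀ {x y} z → x ≤ y → z + x ≤ z + y
  +-monoʳ-≤ z (inj₁ x<y)  = inj₁ (+-monoʳ-< z x<y)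
  +-monoʳ-≤ z (inj₂ refl) = ≤-refl

  +-mono-≤ : ∀ {a b c d} → a ≤ b → c ≤ d → a + c ≤ b + d
  +-mono-≤ {b = b} {c} a≤b c≤d = ≤-trans (+-monoˡ-≤ c a≤b) (+-monoʳ-≤ b c≤d)

  +-cancelʳ-< : ∀ {x y} z → x + z < y + z → x < y
  +-cancelʳ-< {x} {y} z = subst₂ _<_ (cancel x) (cancel y) ∘′ +-monoˡ-< (- z)
    where
    cancel : ∀ x → x + z + - z ≡ x
    cancel x = solve 2 (λ x z → x :+ z :+ :- z := x) refl x z

  -‿anti-< : ∀ {x y} → x < y → - y < - x
  -‿anti-< {x} {y} x<y = subst₂ _<_ (eqˡ x y) (eqʳ x y) (+-monoˡ-< (- x + - y) x<y)
    where
    eqˡ : ∀ x y → x + (- x + - y) ≡ - y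
    eqˡ = solve 2 (λ x y → x :+ (:- x :+ :- y) := :- y) refl
    eqʳ : ∀ x y → y + (- x + - y) ≡ - x
    eqʳ = solve 2 (λ x y → y :+ (:- x :+ :- y) := :- x) refl

  -‿anti-≤ : ∀ {x y} → x ≤ y → - y ≤ - x
  -‿anti-≤ (inj₁ x<y)  = inj₁ (-‿anti-< x<y)
  -‿anti-≤ (inj₂ refl) = ≤-refl

  0<-‿ : ∀ {x} → x < 0# → 0# < - x
  0<-‿ x<0 = subst (_< _) -0#≡0# (-‿anti-< x<0)

  -≤0# : ∀ {x} → 0# ≤ x → - x ≤ 0#
  -≤0# 0≤x = subst (_ ≤_) -0#≡0# (-‿anti-≤ 0≤x)

  0<1 : 0# < 1#
  0<1 with compare 0# 1#
  ... | tri< 0<1 _ _ = 0<1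
  ... | tri≈ _ 0≡1 _ = ⊥-elim (0≢1 0≡1)
  ... | tri> _ _ 1<0 = ⊥-elim (<-irrefl (<-trans 1<0 (subst (0# <_) (trans (-‿*-‿ 1# 1#) (*-identityˡ 1#)) (*-pos (0<-‿ 1<0) (0<-‿ 1<0)))))

  *-monoˡ-< : ∀ {c x y} → 0# < c → x < y → c * x < c * y
  *-monoˡ-< {c} {x} {y} 0<c x<y = subst₂ _<_ (+-identityˡ (c * x)) (cancel c x y) (+-monoˡ-< (c * x) c[y-x]>0)
    where
    c[y-x]>0 : 0# < c * (y + - x)
    c[y-x]>0 = *-pos 0<c (subst (_< y + - x) (-‿inverseʳ x) (+-monoˡ-< (- x) x<y))
    cancel : ∀ c x y → c * (y + - x) + c * x ≡ c * y
    cancel = solve 3 (λ c x y → c :* (y :+ :- x) :+ c :* x := c :* y) refl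

  *-monoˡ-≤ : ∀ {c x y} → 0# ≤ c → x ≤ y → c * x ≤ c * y
  *-monoˡ-≤ (inj₁ 0<c) (inj₁ x<y)      = inj₁ (*-monoˡ-< 0<c x<y)
  *-monoˡ-≤ (inj₁ 0<c) (inj₂ refl)     = ≤-refl
  *-monoˡ-≤ {x = x} {y} (inj₂ refl) _ = inj₂ (trans (zeroˡ x) (sym (zeroˡ y)))

  *-monoʳ-≤ : ∀ {c x y} → 0# ≤ c → x ≤ y → x * c ≤ y * c
  *-monoʳ-≤ {c} {x} {y} 0≤c x≤y = subst₂ _≤_ (*-comm c x) (*-comm c y) (*-monoˡ-≤ 0≤c x≤y)

  *-antiˡ-< : ∀ {c x y} → c < 0# → x < y → c * y < c * x
  *-antiˡ-< {c} {x} {y} c<0 x<y = subst₂ _<_ (minus-minus c y) (minus-minus c x) (-‿anti-< (*-monoˡ-< (0<-‿ c<0) x<y))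
    where
    minus-minus : ∀ c x → - (- c * x) ≡ c * x
    minus-minus = solve 2 (λ c x → :- (:- c :* x) := c :* x) refl

  *-antiˡ-≤ : ∀ {c x y} → c ≤ 0# → x ≤ y → c * y ≤ c * x
  *-antiˡ-≤ (inj₁ c<0) (inj₁ x<y)      = inj₁ (*-antiˡ-< c<0 x<y)
  *-antiˡ-≤ (inj₁ c<0) (inj₂ refl)     = ≤-refl
  *-antiˡ-≤ {x = x} {y} (inj₂ refl) _ = inj₂ (trans (zeroˡ y) (sym (zeroˡ x)))

  *-cancelʳ-< : ∀ {c x y} → 0# < c → x * c < y * c → x < y
  *-cancelʳ-< {c} {x} {y} 0<c xc<yc with compare x y
  ... | tri< x<y _ _  = x<y
  ... | tri≈ _ refl _ = ⊥-elim (<-irrefl xc<yc)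
  ... | tri> _ _ y<x  = ⊥-elim (<-irrefl (<-trans xc<yc (subst₂ _<_ (*-comm c y) (*-comm c x) (*-monoˡ-< 0<c y<x))))

  *-cancelʳ-≤ : ∀ {c x y} → 0# < c → x * c ≤ y * c → x ≤ y
  *-cancelʳ-≤ {c} {x} {y} 0<c xc≤yc = ≮⇒≥ (λ y<x → ≤⇒≯ xc≤yc (subst₂ _<_ (*-comm c y) (*-comm c x) (*-monoˡ-< 0<c y<x)))

  0≤-* : ∀ {x y} → 0# ≤ x → 0# ≤ y → 0# ≤ x * y
  0≤-* {x} 0≤x 0≤y = subst (_≤ _) (zeroʳ x) (*-monoˡ-≤ 0≤x 0≤y)

  *-inverseʳ : ∀ {x} → 0# < x → x * x ⁻¹ ≡ 1#
  *-inverseʳ 0<x = ⁻¹-inverse _ (λ x≡0 → <-irrefl (subst (0# <_) x≡0 0<x))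

  *-inverseˡ : ∀ {x} → 0# < x → x ⁻¹ * x ≡ 1#
  *-inverseˡ {x} 0<x = trans (*-comm (x ⁻¹) x) (*-inverseʳ 0<x)

  0<⁻¹ : ∀ {x} → 0# < x → 0# < x ⁻¹
  0<⁻¹ {x} 0<x with compare 0# (x ⁻¹)
  ... | tri< 0<x⁻¹ _ _ = 0<x⁻¹
  ... | tri≈ _ 0≡x⁻¹ _ = ⊥-elim (0≢1 (trans (sym (zeroʳ x)) (trans (cong (x *_) 0≡x⁻¹) (*-inverseʳ 0<x))))
  ... | tri> _ _ x⁻¹<0 = ⊥-elim (<-irrefl (<-trans 0<1 (subst₂ _<_ (*-inverseʳ 0<x) (zeroʳ x) (*-monoˡ-< 0<x x⁻¹<0))))

  open ≡-Reasoning

  abs : Carrier → Carrier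
  abs x with compare 0# x
  ... | tri< _ _ _ = x
  ... | tri≈ _ _ _ = x
  ... | tri> _ _ _ = - x

  abs-cases : ∀ x → (abs x ≡ x × 0# ≤ x) ⊎ (abs x ≡ - x × x < 0#)
  abs-cases x with compare 0# x
  ... | tri< 0<x _ _ = inj₁ (refl , inj₁ 0<x)
  ... | tri≈ _ 0≡x _ = inj₁ (refl , inj₂ 0≡x)
  ... | tri> _ _ x<0 = inj₂ (refl , x<0)

  abs-nonneg : ∀ {x} → 0# ≤ x → abs x ≡ x
  abs-nonneg {x} 0≤x with abs-cases x
  ... | inj₁ (abs≡x , _) = abs≡x
  ... | inj₂ (_ , x<0)   = ⊥-elim (≤⇒≯ 0≤x x<0)

  0≤abs : ∀ x → 0# ≤ abs x
  0≤abs x with abs-cases x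
  ... | inj₁ (abs≡x , 0≤x)  = subst (0# ≤_) (sym abs≡x) 0≤x
  ... | inj₂ (abs≡-x , x<0) = subst (0# ≤_) (sym abs≡-x) (inj₁ (0<-‿ x<0))

  ≤abs : ∀ x → x ≤ abs x
  ≤abs x with abs-cases x
  ... | inj₁ (abs≡x , _)    = inj₂ (sym abs≡x)
  ... | inj₂ (abs≡-x , x<0) = subst (x ≤_) (sym abs≡-x) (inj₁ (<-trans x<0 (0<-‿ x<0)))

  -≤abs : ∀ x → - x ≤ abs x
  -≤abs x with abs-cases x
  ... | inj₁ (abs≡x , 0≤x) = subst (- x ≤_) (sym abs≡x) (≤-trans (-≤0# 0≤x) 0≤x)
  ... | inj₂ (abs≡-x , _)  = inj₂ (sym abs≡-x)

  abs-triangle : ∀ x y → abs (x + y) ≤ abs x + abs y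
  abs-triangle x y with abs-cases (x + y)
  ... | inj₁ (abs≡ , _) = subst (_≤ abs x + abs y) (sym abs≡) (+-mono-≤ (≤abs x) (≤abs y))
  ... | inj₂ (abs≡ , _) = subst (_≤ abs x + abs y) (sym (trans abs≡ (-‿+ x y))) (+-mono-≤ (-≤abs x) (-≤abs y))

  abs-nonpos : ∀ {x} → x ≤ 0# → abs x ≡ - x
  abs-nonpos {x} x≤0 with abs-cases x
  ... | inj₂ (abs≡-x , _)  = abs≡-x
  ... | inj₁ (abs≡x , 0≤x) with x≤0
  ...   | inj₁ x<0  = ⊥-elim (≤⇒≯ 0≤x x<0)
  ...   | inj₂ refl = trans abs≡x (sym -0#≡0#)

  abs-‿ : ∀ x → abs (- x) ≡ abs x
  abs-‿ x with abs-cases x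
  ... | inj₁ (abs≡x , 0≤x)  = trans (abs-nonpos (-≤0# 0≤x)) (trans (-‿involutive x) (sym abs≡x))
  ... | inj₂ (abs≡-x , x<0) = trans (abs-nonneg (inj₁ (0<-‿ x<0))) (sym abs≡-x)

  abs-* : ∀ x y → abs (x * y) ≡ abs x * abs y
  abs-* x y with abs-cases x | abs-cases y
  ... | inj₁ (abs≡x , 0≤x) | inj₁ (abs≡y , 0≤y) = begin
    abs (x * y)        ≡⟨ abs-nonneg (0≤-* 0≤x 0≤y) ⟩
    x * y              ≡⟨ cong₂ _*_ abs≡x abs≡y ⟨
    abs x * abs y      ∎
  ... | inj₁ (abs≡x , 0≤x) | inj₂ (abs≡-y , y<0) = begin
    abs (x * y)        ≡⟨ abs-‿ (x * y) ⟨
    abs (- (x * y))    ≡⟨ cong abs (-‿distribʳ-* x y) ⟩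
    abs (x * - y)      ≡⟨ abs-nonneg (0≤-* 0≤x (inj₁ (0<-‿ y<0))) ⟩
    x * - y            ≡⟨ cong₂ _*_ abs≡x abs≡-y ⟨
    abs x * abs y      ∎
  ... | inj₂ (abs≡-x , x<0) | inj₁ (abs≡y , 0≤y) = begin
    abs (x * y)        ≡⟨ abs-‿ (x * y) ⟨
    abs (- (x * y))    ≡⟨ cong abs (-‿distribˡ-* x y) ⟩
    abs (- x * y)      ≡⟨ abs-nonneg (0≤-* (inj₁ (0<-‿ x<0)) 0≤y) ⟩
    - x * y            ≡⟨ cong₂ _*_ abs≡-x abs≡y ⟨
    abs x * abs y      ∎
  ... | inj₂ (abs≡-x , x<0) | inj₂ (abs≡-y , y<0) = begin
    abs (x * y)        ≡⟨ cong abs (-‿*-‿ x y) ⟨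
    abs (- x * - y)    ≡⟨ abs-nonneg (inj₁ (*-pos (0<-‿ x<0) (0<-‿ y<0))) ⟩
    - x * - y          ≡⟨ cong₂ _*_ abs≡-x abs≡-y ⟨
    abs x * abs y      ∎

module SumProperties (F : OrderedField) where
  open Matrices F
  open OrderedFieldProperties F
  open ≡-Reasoning

  sum-cong : ∀ {n} {f g : Fin n → Carrier} → (∀ i → f i ≡ g i) → sum f ≡ sum g
  sum-cong {zero}  f≡g = refl
  sum-cong {suc n} f≡g = cong₂ _+_ (f≡g zero) (sum-cong (λ i → f≡g (suc i)))

  sum-0# : ∀ {n} {f : Fin n → Carrier} → (∀ i → f i ≡ 0#) → sum f ≡ 0#
  sum-0# {zero}  f≡0 = refl
  sum-0# {suc n} f≡0 = trans (cong₂ _+_ (f≡0 zero) (sum-0# (λ i → f≡0 (suc i)))) (+-identityˡ 0#)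

  sum-+ : ∀ {n} (f g : Fin n → Carrier) → sum (λ i → f i + g i) ≡ sum f + sum g
  sum-+ {zero}  f g = sym (+-identityˡ 0#)
  sum-+ {suc n} f g = trans (cong ((f zero + g zero) +_) (sum-+ (f ∘′ suc) (g ∘′ suc)))
                            (interchange (f zero) (g zero) _ _)

  sum-*ˡ : ∀ {n} c (f : Fin n → Carrier) → c * sum f ≡ sum (λ i → c * f i)
  sum-*ˡ {zero}  c f = zeroʳ c
  sum-*ˡ {suc n} c f = trans (distribˡ c _ _) (cong (c * f zero +_) (sum-*ˡ c (f ∘′ suc)))

  sum-*ʳ : ∀ {n} c (f : Fin n → Carrier) → sum f * c ≡ sum (λ i → f i * c)
  sum-*ʳ c f = trans (*-comm _ c) (trans (sum-*ˡ c f) (sum-cong (λ i → *-comm c (f i))))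

  sum-‿ : ∀ {n} (f : Fin n → Carrier) → sum (λ i → - f i) ≡ - sum f
  sum-‿ {zero}  f = sym -0#≡0#
  sum-‿ {suc n} f = trans (cong (- f zero +_) (sum-‿ (f ∘′ suc))) (sym (-‿+ _ _))

  sum-swap : ∀ {m n} (f : Fin m → Fin n → Carrier) →
             sum (λ i → sum (λ j → f i j)) ≡ sum (λ j → sum (λ i → f i j))
  sum-swap {zero} {n} f = sym (sum-0# {n} (λ _ → refl))
  sum-swap {suc m} f = trans (cong (sum (f zero) +_) (sum-swap (f ∘′ suc)))
                             (sym (sum-+ (f zero) (λ j → sum (λ i → f (suc i) j))))

  sum-mono-≤ : ∀ {n} {f g : Fin n → Carrier} → (∀ i → f i ≤ g i) → sum f ≤ sum g
  sum-mono-≤ {zero}  f≤g = ≤-refl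
  sum-mono-≤ {suc n} f≤g = +-mono-≤ (f≤g zero) (sum-mono-≤ (λ i → f≤g (suc i)))

  sum-nonneg : ∀ {n} {f : Fin n → Carrier} → (∀ i → 0# ≤ f i) → 0# ≤ sum f
  sum-nonneg {n} {f} 0≤f = subst (_≤ sum f) (sum-0# {n} {λ _ → 0#} (λ _ → refl)) (sum-mono-≤ 0≤f)

  sum-single : ∀ {n} (j : Fin n) (f : Fin n → Carrier) → (∀ k → k ≢ j → f k ≡ 0#) → sum f ≡ f j
  sum-single zero    f f≡0 = trans (cong (f zero +_) (sum-0# (λ k → f≡0 (suc k) λ ()))) (+-identityʳ _)
  sum-single (suc j) f f≡0 = trans (cong₂ _+_ (f≡0 zero λ ()) (sum-single j (f ∘′ suc) λ k k≢j → f≡0 (suc k) (k≢j ∘′ suc-injective)))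
                                   (+-identityˡ _)

  except : ∀ {n} → Fin n → (Fin n → Carrier) → Fin n → Carrier
  except i f j with j ≟ i
  ... | yes _ = 0#
  ... | no  _ = f j

  sumExcept : ∀ {n} → Fin n → (Fin n → Carrier) → Carrier
  sumExcept i f = sum (except i f)

  except-suc : ∀ {n} (i j : Fin n) (f : Fin (suc n) → Carrier) → except (suc i) f (suc j) ≡ except i (f ∘′ suc) j
  except-suc i j f with j ≟ i
  ... | yes refl = refl
  ... | no  _    = refl

  sum-except : ∀ {n} (i : Fin n) (f : Fin n → Carrier) → sum f ≡ f i + sumExcept i f
  sum-except zero    f = cong (f zero +_) (sym (+-identityˡ _))
  sum-except (suc i) f = begin
    f zero + sum (f ∘′ suc)                                   ≡⟨ cong (f zero +_) (sum-except i (f ∘′ suc)) ⟩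
    f zero + (f (suc i) + sumExcept i (f ∘′ suc))             ≡⟨ solve 3 (λ a b c → a :+ (b :+ c) := b :+ (a :+ c)) refl (f zero) (f (suc i)) _ ⟩
    f (suc i) + (f zero + sumExcept i (f ∘′ suc))             ≡⟨ cong (λ s → f (suc i) + (f zero + s)) (sum-cong (λ j → except-suc i j f)) ⟨
    f (suc i) + sumExcept (suc i) f                           ∎

  except-pointwise : ∀ {n} (i : Fin n) {f g : Fin n → Carrier} {_R_ : Carrier → Carrier → Set} →
    _R_ 0# 0# → (∀ j → j ≢ i → f j R g j) → ∀ j → except i f j R except i g j
  except-pointwise i 0R0 fRg j with j ≟ i
  ... | yes _   = 0R0
  ... | no  j≢i = fRg j j≢i

  sumExcept-cong : ∀ {n} (i : Fin n) {f g : Fin n → Carrier} → (∀ j → j ≢ i → f j ≡ g j) → sumExcept i f ≡ sumExcept i g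
  sumExcept-cong i f≡g = sum-cong (except-pointwise i {_R_ = _≡_} refl f≡g)

  sumExcept-mono-≤ : ∀ {n} (i : Fin n) {f g : Fin n → Carrier} → (∀ j → j ≢ i → f j ≤ g j) → sumExcept i f ≤ sumExcept i g
  sumExcept-mono-≤ i f≤g = sum-mono-≤ (except-pointwise i {_R_ = _≤_} ≤-refl f≤g)

  sumExcept-nonneg : ∀ {n} (i : Fin n) {f : Fin n → Carrier} → (∀ j → j ≢ i → 0# ≤ f j) → 0# ≤ sumExcept i f
  sumExcept-nonneg i 0≤f = sum-nonneg (except-pointwise i {f = λ _ → 0#} {_R_ = λ _ y → 0# ≤ y} ≤-refl 0≤f)

  sumExcept-+ : ∀ {n} (i : Fin n) f g → sumExcept i (λ j → f j + g j) ≡ sumExcept i f + sumExcept i g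
  sumExcept-+ i f g = trans (sum-cong pointwise) (sum-+ (except i f) (except i g))
    where
    pointwise : ∀ j → except i (λ j → f j + g j) j ≡ except i f j + except i g j
    pointwise j with j ≟ i
    ... | yes _ = sym (+-identityˡ 0#)
    ... | no  _ = refl

  sumExcept-*ˡ : ∀ {n} (i : Fin n) c f → c * sumExcept i f ≡ sumExcept i (λ j → c * f j)
  sumExcept-*ˡ i c f = trans (sum-*ˡ c (except i f)) (sum-cong pointwise)
    where
    pointwise : ∀ j → c * except i f j ≡ except i (λ j → c * f j) j
    pointwise j with j ≟ i
    ... | yes _ = zeroʳ c
    ... | no  _ = refl

module MatrixProperties (F : OrderedField) where
  open Matrices F
  open OrderedFieldProperties F
  open SumProperties F
  open ≡-Reasoning

  I-diagonal : ∀ {n} (i : Fin n) → I i i ≡ 1#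
  I-diagonal i with i ≟ i
  ... | yes _   = refl
  ... | no  i≢i = ⊥-elim (i≢i refl)

  I-off-diagonal : ∀ {n} {i j : Fin n} → i ≢ j → I i j ≡ 0#
  I-off-diagonal {i = i} {j} i≢j with i ≟ j
  ... | yes i≡j = ⊥-elim (i≢j i≡j)
  ... | no  _   = refl

  I-suc : ∀ {n} (i j : Fin n) → I (suc i) (suc j) ≡ I i j
  I-suc i j with i ≟ j
  ... | yes refl = refl
  ... | no  _    = refl

  diag-diagonal : ∀ {n} (v : Vector n) i → diag v i i ≡ v i
  diag-diagonal v i with i ≟ i
  ... | yes _   = refl
  ... | no  i≢i = ⊥-elim (i≢i refl)

  diag-off-diagonal : ∀ {n} (v : Vector n) {i j} → i ≢ j → diag v i j ≡ 0#
  diag-off-diagonal v {i} {j} i≢j with i ≟ j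
  ... | yes i≡j = ⊥-elim (i≢j i≡j)
  ... | no  _   = refl

  sum-*I : ∀ {n} (f : Fin n → Carrier) j → sum (λ k → f k * I k j) ≡ f j
  sum-*I f j = begin
    sum (λ k → f k * I k j) ≡⟨ sum-single j _ (λ k k≢j → trans (cong (f k *_) (I-off-diagonal k≢j)) (zeroʳ _)) ⟩
    f j * I j j             ≡⟨ cong (f j *_) (I-diagonal j) ⟩
    f j * 1#                ≡⟨ *-identityʳ _ ⟩
    f j                     ∎

  sum-I* : ∀ {n} (f : Fin n → Carrier) i → sum (λ k → I i k * f k) ≡ f i
  sum-I* f i = trans (sum-cong (λ k → *-comm (I i k) (f k)))
                     (trans (sum-cong (λ k → cong (f k *_) (I-symmetric k))) (sum-*I f i))
    where
    I-symmetric : ∀ k → I i k ≡ I k i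
    I-symmetric k with i ≟ k | k ≟ i
    ... | yes _   | yes _   = refl
    ... | yes i≡k | no  k≢i = ⊥-elim (k≢i (sym i≡k))
    ... | no  i≢k | yes k≡i = ⊥-elim (i≢k (sym k≡i))
    ... | no  _   | no  _   = refl

  sum-*diag : ∀ {n} (f : Fin n → Carrier) (v : Vector n) j → sum (λ k → f k * diag v k j) ≡ f j * v j
  sum-*diag f v j = trans (sum-single j _ (λ k k≢j → trans (cong (f k *_) (diag-off-diagonal v k≢j)) (zeroʳ _)))
                          (cong (f j *_) (diag-diagonal v j))

  sum-diag* : ∀ {n} (v : Vector n) (f : Fin n → Carrier) i → sum (λ k → diag v i k * f k) ≡ v i * f i
  sum-diag* v f i = trans (sum-single i _ (λ k k≢i → trans (cong (_* f k) (diag-off-diagonal v (k≢i ∘′ sym))) (zeroˡ _)))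
                          (cong (_* f i) (diag-diagonal v i))

  sum-sum-assoc : ∀ {m n} (x : Fin m → Carrier) (B : Fin m → Fin n → Carrier) (y : Fin n → Carrier) →
    sum (λ k → sum (λ l → x l * B l k) * y k) ≡ sum (λ l → x l * sum (λ k → B l k * y k))
  sum-sum-assoc x B y = begin
    sum (λ k → sum (λ l → x l * B l k) * y k)   ≡⟨ sum-cong (λ k → sum-*ʳ (y k) (λ l → x l * B l k)) ⟩
    sum (λ k → sum (λ l → x l * B l k * y k))   ≡⟨ sum-swap (λ k l → x l * B l k * y k) ⟩
    sum (λ l → sum (λ k → x l * B l k * y k))   ≡⟨ sum-cong (λ l → sum-cong (λ k → *-assoc (x l) (B l k) (y k))) ⟩
    sum (λ l → sum (λ k → x l * (B l k * y k))) ≡⟨ sum-cong (λ l → sum-*ˡ (x l) (λ k → B l k * y k)) ⟨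
    sum (λ l → x l * sum (λ k → B l k * y k))   ∎

  ·-·ᵥ-assoc : ∀ {n} (A B : Matrix n) (v : Vector n) i → ((A · B) ·ᵥ v) i ≡ (A ·ᵥ (B ·ᵥ v)) i
  ·-·ᵥ-assoc A B v i = sum-sum-assoc (A i) B v

  inverse-·ᵥ : ∀ {n} {A N : Matrix n} → IsInverse A N → ∀ v i → (A ·ᵥ (N ·ᵥ v)) i ≡ v i
  inverse-·ᵥ {A = A} {N} (AN≡I , _) v i = begin
    (A ·ᵥ (N ·ᵥ v)) i    ≡⟨ ·-·ᵥ-assoc A N v i ⟨
    ((A · N) ·ᵥ v) i     ≡⟨ sum-cong (λ k → cong (_* v k) (AN≡I i k)) ⟩
    (I ·ᵥ v) i           ≡⟨ sum-I* v i ⟩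
    v i                  ∎


  inverse-rowScaled : ∀ {n} {A M N : Matrix n} (τ : Vector n) → (∀ k → τ k * τ k ≡ 1#) →
                      (∀ i k → A i k ≡ τ i * M i k) → IsInverse M N → IsInverse A (λ i j → N i j * τ j)
  inverse-rowScaled {A = A} {M} {N} τ τ²≡1 A≡τM (MN≡I , NM≡I) = AN′≡I , N′A≡I
    where
    τIτ≡I : ∀ i j → τ i * I i j * τ j ≡ I i j
    τIτ≡I i j with i ≟ j
    ... | yes refl = trans (cong (_* τ i) (*-identityʳ (τ i))) (τ²≡1 i)
    ... | no  _    = trans (cong (_* τ j) (zeroʳ (τ i))) (zeroˡ (τ j))

    AN′≡I : ∀ i j → sum (λ k → A i k * (N k j * τ j)) ≡ I i j
    AN′≡I i j = begin
      sum (λ k → A i k * (N k j * τ j))            ≡⟨ sum-cong (λ k → cong (_* (N k j * τ j)) (A≡τM i k)) ⟩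
      sum (λ k → τ i * M i k * (N k j * τ j))      ≡⟨ sum-cong (λ k → solve 4 (λ s m x t → s :* m :* (x :* t) := s :* (m :* x) :* t) refl (τ i) (M i k) (N k j) (τ j)) ⟩
      sum (λ k → τ i * (M i k * N k j) * τ j)      ≡⟨ sum-*ʳ (τ j) (λ k → τ i * (M i k * N k j)) ⟨
      sum (λ k → τ i * (M i k * N k j)) * τ j      ≡⟨ cong (_* τ j) (sum-*ˡ (τ i) (λ k → M i k * N k j)) ⟨
      τ i * (M · N) i j * τ j                      ≡⟨ cong (λ x → τ i * x * τ j) (MN≡I i j) ⟩
      τ i * I i j * τ j                            ≡⟨ τIτ≡I i j ⟩
      I i j                                        ∎

    N′A≡I : ∀ i j → sum (λ k → N i k * τ k * A k j) ≡ I i j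
    N′A≡I i j = begin
      sum (λ k → N i k * τ k * A k j)              ≡⟨ sum-cong (λ k → cong (N i k * τ k *_) (A≡τM k j)) ⟩
      sum (λ k → N i k * τ k * (τ k * M k j))      ≡⟨ sum-cong (λ k → solve 3 (λ x t m → x :* t :* (t :* m) := x :* m :* (t :* t)) refl (N i k) (τ k) (M k j)) ⟩
      sum (λ k → N i k * M k j * (τ k * τ k))      ≡⟨ sum-cong (λ k → trans (cong (N i k * M k j *_) (τ²≡1 k)) (*-identityʳ _)) ⟩
      (N · M) i j                                  ≡⟨ NM≡I i j ⟩
      I i j                                        ∎

module SchurComplement (F : OrderedField) {m : ℕ} (A : Matrices.Matrix F (suc m)) where
  open Matrices F
  open OrderedFieldProperties F
  open SumProperties F
  open MatrixProperties F
  open ≡-Reasoning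

  a : Carrier
  a = A zero zero

  r c : Vector m
  r j = A zero (suc j)
  c i = A (suc i) zero

  A′ : Matrix m
  A′ i j = A (suc i) (suc j)

  schur : Matrix m
  schur i j = A′ i j + - (c i * a ⁻¹ * r j)

  A′≡schur+ : ∀ i j → A′ i j ≡ schur i j + c i * a ⁻¹ * r j
  A′≡schur+ i j = solve 2 (λ x y → x := x :+ :- y :+ y) refl (A′ i j) (c i * a ⁻¹ * r j)

  A′-·ᵥ : ∀ (f : Vector m) i → (A′ ·ᵥ f) i ≡ (schur ·ᵥ f) i + c i * a ⁻¹ * sum (λ k → r k * f k)
  A′-·ᵥ f i = begin
    (A′ ·ᵥ f) i                                                    ≡⟨ sum-cong (λ k → cong (_* f k) (A′≡schur+ i k)) ⟩
    sum (λ k → (schur i k + c i * a ⁻¹ * r k) * f k)               ≡⟨ sum-cong (λ k → solve 4 (λ s x y z → (s :+ x :* y) :* z := s :* z :+ x :* (y :* z)) refl (schur i k) (c i * a ⁻¹) (r k) (f k)) ⟩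
    sum (λ k → schur i k * f k + c i * a ⁻¹ * (r k * f k))         ≡⟨ sum-+ (λ k → schur i k * f k) (λ k → c i * a ⁻¹ * (r k * f k)) ⟩
    (schur ·ᵥ f) i + sum (λ k → c i * a ⁻¹ * (r k * f k))          ≡⟨ cong ((schur ·ᵥ f) i +_) (sum-*ˡ (c i * a ⁻¹) (λ k → r k * f k)) ⟨
    (schur ·ᵥ f) i + c i * a ⁻¹ * sum (λ k → r k * f k)            ∎

  ·-A′ : ∀ (g : Vector m) j → sum (λ k → g k * A′ k j) ≡ sum (λ k → g k * schur k j) + sum (λ k → g k * c k) * (a ⁻¹ * r j)
  ·-A′ g j = begin
    sum (λ k → g k * A′ k j)                                       ≡⟨ sum-cong (λ k → cong (g k *_) (A′≡schur+ k j)) ⟩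
    sum (λ k → g k * (schur k j + c k * a ⁻¹ * r j))               ≡⟨ sum-cong (λ k → solve 5 (λ z s x b y → z :* (s :+ x :* b :* y) := z :* s :+ z :* x :* (b :* y)) refl (g k) (schur k j) (c k) (a ⁻¹) (r j)) ⟩
    sum (λ k → g k * schur k j + g k * c k * (a ⁻¹ * r j))         ≡⟨ sum-+ (λ k → g k * schur k j) (λ k → g k * c k * (a ⁻¹ * r j)) ⟩
    sum (λ k → g k * schur k j) + sum (λ k → g k * c k * (a ⁻¹ * r j)) ≡⟨ cong (sum (λ k → g k * schur k j) +_) (sum-*ʳ (a ⁻¹ * r j) (λ k → g k * c k)) ⟨
    sum (λ k → g k * schur k j) + sum (λ k → g k * c k) * (a ⁻¹ * r j) ∎

  module _ (T : Matrix m) where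
    u v : Vector m
    u i = sum (λ l → T i l * c l)
    v j = sum (λ k → r k * T k j)

    ρ : Carrier
    ρ = sum (λ k → r k * u k)

    -- The block inverse of [[a , r] , [c , A′]] with S = schur and T = S⁻¹:
    -- [[a⁻¹ + a⁻¹ (r T c) a⁻¹ , − a⁻¹ (r T)] , [− (T c) a⁻¹ , T]].
    blockInverse : Matrix (suc m)
    blockInverse zero    zero    = a ⁻¹ + a ⁻¹ * ρ * a ⁻¹
    blockInverse zero    (suc j) = - (a ⁻¹ * v j)
    blockInverse (suc i) zero    = - (u i * a ⁻¹)
    blockInverse (suc i) (suc j) = T i j

    private
      sum-*-‿ : ∀ (x y : Vector m) z → sum (λ k → x k * - (y k * z)) ≡ - (sum (λ k → x k * y k) * z)
      sum-*-‿ x y z = begin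
        sum (λ k → x k * - (y k * z))   ≡⟨ sum-cong (λ k → solve 3 (λ x y z → x :* :- (y :* z) := :- (x :* y :* z)) refl (x k) (y k) z) ⟩
        sum (λ k → - (x k * y k * z))   ≡⟨ sum-‿ (λ k → x k * y k * z) ⟩
        - sum (λ k → x k * y k * z)     ≡⟨ cong -_ (sum-*ʳ z (λ k → x k * y k)) ⟨
        - (sum (λ k → x k * y k) * z)   ∎

      sum-‿-* : ∀ z (y x : Vector m) → sum (λ k → - (z * y k) * x k) ≡ - (z * sum (λ k → y k * x k))
      sum-‿-* z y x = begin
        sum (λ k → - (z * y k) * x k)   ≡⟨ sum-cong (λ k → solve 3 (λ z y x → :- (z :* y) :* x := :- (z :* (y :* x))) refl z (y k) (x k)) ⟩
        sum (λ k → - (z * (y k * x k))) ≡⟨ sum-‿ (λ k → z * (y k * x k)) ⟩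
        - sum (λ k → z * (y k * x k))   ≡⟨ cong -_ (sum-*ˡ z (λ k → y k * x k)) ⟨
        - (z * sum (λ k → y k * x k))   ∎

    blockInverse-right : a * a ⁻¹ ≡ 1# → (∀ i j → (schur · T) i j ≡ I i j) → ∀ i j → (A · blockInverse) i j ≡ I i j
    blockInverse-right aa⁻¹≡1 ST≡I = entry
      where
      schur·u : ∀ i → (schur ·ᵥ u) i ≡ c i
      schur·u i = trans (sym (·-·ᵥ-assoc schur T c i)) (trans (sum-cong (λ k → cong (_* c k) (ST≡I i k))) (sum-I* c i))

      entry : ∀ i j → (A · blockInverse) i j ≡ I i j
      entry zero zero = begin
        a * (a ⁻¹ + a ⁻¹ * ρ * a ⁻¹) + sum (λ k → r k * - (u k * a ⁻¹))
          ≡⟨ cong (a * (a ⁻¹ + a ⁻¹ * ρ * a ⁻¹) +_) (sum-*-‿ r u (a ⁻¹)) ⟩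
        a * (a ⁻¹ + a ⁻¹ * ρ * a ⁻¹) + - (ρ * a ⁻¹)
          ≡⟨ solve 3 (λ a b ρ → a :* (b :+ b :* ρ :* b) :+ :- (ρ :* b) := a :* b :+ a :* b :* (ρ :* b) :+ :- (ρ :* b)) refl a (a ⁻¹) ρ ⟩
        a * a ⁻¹ + a * a ⁻¹ * (ρ * a ⁻¹) + - (ρ * a ⁻¹)
          ≡⟨ cong (λ e → e + e * (ρ * a ⁻¹) + - (ρ * a ⁻¹)) aa⁻¹≡1 ⟩
        1# + 1# * (ρ * a ⁻¹) + - (ρ * a ⁻¹)
          ≡⟨ cong (λ x → 1# + x + - (ρ * a ⁻¹)) (*-identityˡ (ρ * a ⁻¹)) ⟩
        1# + ρ * a ⁻¹ + - (ρ * a ⁻¹)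
          ≡⟨ solve 2 (λ o x → o :+ x :+ :- x := o) refl 1# (ρ * a ⁻¹) ⟩
        1# ∎
      entry zero (suc j) = begin
        a * - (a ⁻¹ * v j) + v j      ≡⟨ solve 3 (λ a b x → a :* :- (b :* x) :+ x := :- (a :* b :* x) :+ x) refl a (a ⁻¹) (v j) ⟩
        - (a * a ⁻¹ * v j) + v j      ≡⟨ cong (λ e → - (e * v j) + v j) aa⁻¹≡1 ⟩
        - (1# * v j) + v j            ≡⟨ cong (λ x → - x + v j) (*-identityˡ (v j)) ⟩
        - v j + v j                   ≡⟨ -‿inverseˡ (v j) ⟩
        0#                            ∎
      entry (suc i) zero = begin
        c i * N₀₀ + sum (λ k → A′ i k * - (u k * a ⁻¹))   ≡⟨ cong (c i * N₀₀ +_) (sum-*-‿ (A′ i) u (a ⁻¹)) ⟩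
        c i * N₀₀ + - ((A′ ·ᵥ u) i * a ⁻¹)              ≡⟨ cong (λ x → c i * N₀₀ + - (x * a ⁻¹)) (A′-·ᵥ u i) ⟩
        c i * N₀₀ + - (((schur ·ᵥ u) i + c i * a ⁻¹ * ρ) * a ⁻¹)
          ≡⟨ cong (λ x → c i * N₀₀ + - ((x + c i * a ⁻¹ * ρ) * a ⁻¹)) (schur·u i) ⟩
        c i * N₀₀ + - ((c i + c i * a ⁻¹ * ρ) * a ⁻¹)
          ≡⟨ solve 3 (λ x b ρ → x :* (b :+ b :* ρ :* b) :+ :- ((x :+ x :* b :* ρ) :* b) := x :* b :+ :- (x :* b)) refl (c i) (a ⁻¹) ρ ⟩
        c i * a ⁻¹ + - (c i * a ⁻¹)                     ≡⟨ -‿inverseʳ _ ⟩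
        0#                                              ∎
        where
        N₀₀ = blockInverse zero zero
      entry (suc i) (suc j) = begin
        c i * - (a ⁻¹ * v j) + sum (λ k → A′ i k * T k j)                         ≡⟨ cong (c i * - (a ⁻¹ * v j) +_) (A′-·ᵥ (λ k → T k j) i) ⟩
        c i * - (a ⁻¹ * v j) + ((schur · T) i j + c i * a ⁻¹ * v j)              ≡⟨ cong (λ x → c i * - (a ⁻¹ * v j) + (x + c i * a ⁻¹ * v j)) (ST≡I i j) ⟩
        c i * - (a ⁻¹ * v j) + (I i j + c i * a ⁻¹ * v j)                         ≡⟨ solve 4 (λ x b y e → x :* :- (b :* y) :+ (e :+ x :* b :* y) := e) refl (c i) (a ⁻¹) (v j) (I i j) ⟩
        I i j                                                                      ≡⟨ I-suc i j ⟨
        I (suc i) (suc j)                                                          ∎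

    blockInverse-left : a ⁻¹ * a ≡ 1# → (∀ i j → (T · schur) i j ≡ I i j) → ∀ i j → (blockInverse · A) i j ≡ I i j
    blockInverse-left a⁻¹a≡1 TS≡I = entry
      where
      v·schur : ∀ j → sum (λ k → v k * schur k j) ≡ r j
      v·schur j = trans (sum-sum-assoc r T (λ k → schur k j)) (trans (sum-cong (λ l → cong (r l *_) (TS≡I l j))) (sum-*I r j))

      v·A′ : ∀ j → sum (λ k → v k * A′ k j) ≡ r j + ρ * (a ⁻¹ * r j)
      v·A′ j = trans (·-A′ v j) (cong₂ (λ x y → x + y * (a ⁻¹ * r j)) (v·schur j) (sum-sum-assoc r T c))

      N₀₀ : Carrier
      N₀₀ = blockInverse zero zero

      entry : ∀ i j → (blockInverse · A) i j ≡ I i j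
      entry zero zero = begin
        N₀₀ * a + sum (λ k → - (a ⁻¹ * v k) * c k)            ≡⟨ cong (N₀₀ * a +_) (sum-‿-* (a ⁻¹) v c) ⟩
        N₀₀ * a + - (a ⁻¹ * sum (λ k → v k * c k))            ≡⟨ cong (λ x → N₀₀ * a + - (a ⁻¹ * x)) (sum-sum-assoc r T c) ⟩
        N₀₀ * a + - (a ⁻¹ * ρ)
          ≡⟨ solve 3 (λ a b ρ → (b :+ b :* ρ :* b) :* a :+ :- (b :* ρ) := b :* a :+ b :* a :* (b :* ρ) :+ :- (b :* ρ)) refl a (a ⁻¹) ρ ⟩
        a ⁻¹ * a + a ⁻¹ * a * (a ⁻¹ * ρ) + - (a ⁻¹ * ρ)       ≡⟨ cong (λ e → e + e * (a ⁻¹ * ρ) + - (a ⁻¹ * ρ)) a⁻¹a≡1 ⟩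
        1# + 1# * (a ⁻¹ * ρ) + - (a ⁻¹ * ρ)                   ≡⟨ cong (λ x → 1# + x + - (a ⁻¹ * ρ)) (*-identityˡ (a ⁻¹ * ρ)) ⟩
        1# + a ⁻¹ * ρ + - (a ⁻¹ * ρ)                          ≡⟨ solve 2 (λ o x → o :+ x :+ :- x := o) refl 1# (a ⁻¹ * ρ) ⟩
        1#                                                    ∎
      entry zero (suc j) = begin
        N₀₀ * r j + sum (λ k → - (a ⁻¹ * v k) * A′ k j)       ≡⟨ cong (N₀₀ * r j +_) (sum-‿-* (a ⁻¹) v (λ k → A′ k j)) ⟩
        N₀₀ * r j + - (a ⁻¹ * sum (λ k → v k * A′ k j))       ≡⟨ cong (λ x → N₀₀ * r j + - (a ⁻¹ * x)) (v·A′ j) ⟩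
        N₀₀ * r j + - (a ⁻¹ * (r j + ρ * (a ⁻¹ * r j)))
          ≡⟨ solve 3 (λ b ρ x → (b :+ b :* ρ :* b) :* x :+ :- (b :* (x :+ ρ :* (b :* x))) := b :* x :+ :- (b :* x)) refl (a ⁻¹) ρ (r j) ⟩
        a ⁻¹ * r j + - (a ⁻¹ * r j)                           ≡⟨ -‿inverseʳ _ ⟩
        0#                                                    ∎
      entry (suc i) zero = begin
        - (u i * a ⁻¹) * a + u i      ≡⟨ solve 3 (λ x b a → :- (x :* b) :* a :+ x := :- (b :* a :* x) :+ x) refl (u i) (a ⁻¹) a ⟩
        - (a ⁻¹ * a * u i) + u i      ≡⟨ cong (λ e → - (e * u i) + u i) a⁻¹a≡1 ⟩
        - (1# * u i) + u i            ≡⟨ cong (λ x → - x + u i) (*-identityˡ (u i)) ⟩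
        - u i + u i                   ≡⟨ -‿inverseˡ (u i) ⟩
        0#                            ∎
      entry (suc i) (suc j) = begin
        - (u i * a ⁻¹) * r j + sum (λ k → T i k * A′ k j)                 ≡⟨ cong (- (u i * a ⁻¹) * r j +_) (·-A′ (T i) j) ⟩
        - (u i * a ⁻¹) * r j + ((T · schur) i j + u i * (a ⁻¹ * r j))    ≡⟨ cong (λ x → - (u i * a ⁻¹) * r j + (x + u i * (a ⁻¹ * r j))) (TS≡I i j) ⟩
        - (u i * a ⁻¹) * r j + (I i j + u i * (a ⁻¹ * r j))               ≡⟨ solve 4 (λ x b y e → :- (x :* b) :* y :+ (e :+ x :* (b :* y)) := e) refl (u i) (a ⁻¹) (r j) (I i j) ⟩
        I i j                                                             ≡⟨ I-suc i j ⟨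
        I (suc i) (suc j)                                                 ∎

    blockInverse-isInverse : a * a ⁻¹ ≡ 1# → IsInverse schur T → IsInverse A blockInverse
    blockInverse-isInverse aa⁻¹≡1 (ST≡I , TS≡I) =
      blockInverse-right aa⁻¹≡1 ST≡I , blockInverse-left (trans (*-comm (a ⁻¹) a) aa⁻¹≡1) TS≡I

module WeightedDominance (F : OrderedField) where
  open Matrices F
  open OrderedFieldProperties F
  open SumProperties F

  WeightedDominant : ∀ {n} → Matrix n → Vector n → Set
  WeightedDominant A w = (∀ i → 0# < w i) × (∀ i → sumExcept i (λ j → abs (A i j) * w j) < abs (A i i) * w i)

  module _ {m} {A : Matrix (suc m)} {w : Vector (suc m)} (dom : WeightedDominant A w) where
    open SchurComplement F A

    private
      0<w = proj₁ dom
      dominant = proj₂ dom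

    pivot≢0 : a ≢ 0#
    pivot≢0 a≡0 = ≤⇒≯ (sumExcept-nonneg zero (λ j _ → 0≤-* (0≤abs (A zero j)) (inj₁ (0<w j))))
                      (subst (sumExcept zero (λ j → abs (A zero j) * w j) <_) |a|w₀≡0 (dominant zero))
      where
      |a|w₀≡0 : abs a * w zero ≡ 0#
      |a|w₀≡0 = trans (cong (λ x → abs x * w zero) a≡0) (trans (cong (_* w zero) (abs-nonneg ≤-refl)) (zeroˡ _))

    w′ : Vector m
    w′ j = w (suc j)

    private
      R : Carrier
      R = sum (λ j → abs (r j) * w′ j)

      row₀ : R < abs a * w zero
      row₀ = subst (_< abs a * w zero) (+-identityˡ R) (dominant zero)

      rowₛ : ∀ i → abs (c i) * w zero + sumExcept i (λ j → abs (A′ i j) * w′ j) < abs (A′ i i) * w′ i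
      rowₛ i = subst (_< abs (A′ i i) * w′ i) (cong (abs (c i) * w zero +_) (sum-cong (λ j → except-suc i j (λ j → abs (A (suc i) j) * w j))))
                     (dominant (suc i))

    schur-dominant-row : ∀ i → sumExcept i (λ j → abs (schur i j) * w′ j) < abs (schur i i) * w′ i
    schur-dominant-row i = +-cancelʳ-< t (begin-strict
      sumExcept i (λ j → abs (schur i j) * w′ j) + t  ≤⟨ +-monoˡ-≤ t off-diagonal ⟩
      P + k * Q + t                                   ≡⟨ +-assoc P (k * Q) t ⟩
      P + (k * Q + t)                                 ≤⟨ +-monoʳ-≤ P pivot-row ⟩
      P + abs (c i) * w zero                          ≡⟨ +-comm P _ ⟩
      abs (c i) * w zero + P                          <⟨ rowₛ i ⟩
      abs (A′ i i) * w′ i                             ≤⟨ diagonal ⟩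
      abs (schur i i) * w′ i + t                      ∎)
      where
      open ≤-Reasoning
      k t P Q : Carrier
      k = abs (c i * a ⁻¹)
      t = k * (abs (r i) * w′ i)
      P = sumExcept i (λ j → abs (A′ i j) * w′ j)
      Q = sumExcept i (λ j → abs (r j) * w′ j)
      off-diagonal : sumExcept i (λ j → abs (schur i j) * w′ j) ≤ P + k * Q
      off-diagonal = begin
        sumExcept i (λ j → abs (schur i j) * w′ j)                             ≤⟨ sumExcept-mono-≤ i (λ j _ → entry j) ⟩
        sumExcept i (λ j → abs (A′ i j) * w′ j + k * (abs (r j) * w′ j))      ≡⟨ sumExcept-+ i _ _ ⟩
        P + sumExcept i (λ j → k * (abs (r j) * w′ j))                         ≡⟨ cong (P +_) (sumExcept-*ˡ i k _) ⟨
        P + k * Q                                                              ∎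
        where
        entry : ∀ j → abs (schur i j) * w′ j ≤ abs (A′ i j) * w′ j + k * (abs (r j) * w′ j)
        entry j = begin
          abs (schur i j) * w′ j                              ≤⟨ *-monoʳ-≤ (inj₁ (0<w (suc j))) (abs-triangle (A′ i j) _) ⟩
          (abs (A′ i j) + abs (- (c i * a ⁻¹ * r j))) * w′ j  ≡⟨ cong (λ x → (abs (A′ i j) + x) * w′ j) (trans (abs-‿ _) (abs-* (c i * a ⁻¹) (r j))) ⟩
          (abs (A′ i j) + k * abs (r j)) * w′ j               ≡⟨ solve 4 (λ s k x w → (s :+ k :* x) :* w := s :* w :+ k :* (x :* w)) refl (abs (A′ i j)) k (abs (r j)) (w′ j) ⟩
          abs (A′ i j) * w′ j + k * (abs (r j) * w′ j)        ∎
      pivot-row : k * Q + t ≤ abs (c i) * w zero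
      pivot-row = begin
        k * Q + t                        ≡⟨ solve 4 (λ k q x w → k :* q :+ k :* (x :* w) := k :* (x :* w :+ q)) refl k Q (abs (r i)) (w′ i) ⟩
        k * (abs (r i) * w′ i + Q)       ≡⟨ cong (k *_) (sum-except i (λ j → abs (r j) * w′ j)) ⟨
        k * R                            ≤⟨ *-monoˡ-≤ (0≤abs _) (inj₁ row₀) ⟩
        k * (abs a * w zero)             ≡⟨ *-assoc k (abs a) (w zero) ⟨
        k * abs a * w zero               ≡⟨ cong (_* w zero) k|a|≡|c| ⟩
        abs (c i) * w zero               ∎
        where
        k|a|≡|c| : k * abs a ≡ abs (c i)
        k|a|≡|c| = trans (sym (abs-* (c i * a ⁻¹) a))
                         (cong abs (trans (*-assoc (c i) (a ⁻¹) a) (trans (cong (c i *_) (trans (*-comm (a ⁻¹) a) (⁻¹-inverse a pivot≢0))) (*-identityʳ (c i)))))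
      diagonal : abs (A′ i i) * w′ i ≤ abs (schur i i) * w′ i + t
      diagonal = begin
        abs (A′ i i) * w′ i                               ≡⟨ cong (λ x → abs x * w′ i) (A′≡schur+ i i) ⟩
        abs (schur i i + c i * a ⁻¹ * r i) * w′ i         ≤⟨ *-monoʳ-≤ (inj₁ (0<w (suc i))) (abs-triangle _ _) ⟩
        (abs (schur i i) + abs (c i * a ⁻¹ * r i)) * w′ i ≡⟨ cong (λ x → (abs (schur i i) + x) * w′ i) (abs-* (c i * a ⁻¹) (r i)) ⟩
        (abs (schur i i) + k * abs (r i)) * w′ i          ≡⟨ solve 4 (λ s k x w → (s :+ k :* x) :* w := s :* w :+ k :* (x :* w)) refl (abs (schur i i)) k (abs (r i)) (w′ i) ⟩
        abs (schur i i) * w′ i + t                        ∎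

    schur-dominant : WeightedDominant schur w′
    schur-dominant = (λ j → 0<w (suc j)) , schur-dominant-row

  weightedDominant⇒invertible : ∀ {n} {A : Matrix n} {w : Vector n} → WeightedDominant A w → Σ (Matrix n) (IsInverse A)
  weightedDominant⇒invertible {zero}      _   = (λ ()) , (λ ()) , (λ ())
  weightedDominant⇒invertible {suc m} {A} dom =
    let T , T-inverse = weightedDominant⇒invertible (schur-dominant dom)
    in  blockInverse T , blockInverse-isInverse T (⁻¹-inverse a (pivot≢0 dom)) T-inverse
    where open SchurComplement F A

module KaykobadPairProperties (F : OrderedField) where
  open Matrices F
  open OrderedFieldProperties F
  open SumProperties F
  open MatrixProperties F
  open WeightedDominance F

  totalOrder : TotalOrder 0ℓ 0ℓ 0ℓ
  totalOrder = StrictTotalOrderProperties.totalOrder (record { isStrictTotalOrder = isStrictTotalOrder })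

  open Data.List.Extrema totalOrder using (argmin; argmax; f[argmin]≤f[xs]; f[xs]≤f[argmax])

  module _ {n} {M : Matrix n} {ν : Vector n} (K : KaykobadPair M ν) where
    private
      0≤M = proj₁ K
      0<Mᵢᵢ = proj₁ (proj₂ K)
      0<ν = proj₁ (proj₂ (proj₂ K))

    weight : Vector n
    weight j = ν j * M j j ⁻¹

    0<weight : ∀ j → 0# < weight j
    0<weight j = *-pos (0<ν j) (0<⁻¹ (0<Mᵢᵢ j))

    M·weight : ∀ j → M j j * weight j ≡ ν j
    M·weight j = trans (solve 3 (λ m x y → m :* (x :* y) := x :* (m :* y)) refl (M j j) (ν j) (M j j ⁻¹))
                       (trans (cong (ν j *_) (*-inverseʳ (0<Mᵢᵢ j))) (*-identityʳ (ν j)))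

    kaykobad-row : ∀ i → sumExcept i (λ j → M i j * weight j) < ν i
    kaykobad-row i = subst (_< ν i) (sum-cong pointwise) (dominated i)
      where
      -- The summand of the Kaykobad condition is local to the definition of
      -- KaykobadPair; it is recovered from the type of the hypothesis to unfold it.
      summand : ∀ {g : Fin n → Fin n → Carrier} → (∀ i → sum (g i) < ν i) → Fin n → Fin n → Carrier
      summand {g} _ = g
      dominated = proj₂ (proj₂ (proj₂ K))
      pointwise : ∀ j → summand dominated i j ≡ except i (λ j → M i j * weight j) j
      pointwise j with j ≟ i
      ... | yes _ = refl
      ... | no  _ = *-assoc (M i j) (ν j) (M j j ⁻¹)

    kaykobad⇒weightedDominant : WeightedDominant M weight
    kaykobad⇒weightedDominant = 0<weight , λ i →
      subst₂ _<_ (sumExcept-cong i (λ j _ → cong (_* weight j) (sym (abs-nonneg (0≤M i j)))))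
                 (trans (sym (M·weight i)) (cong (_* weight i) (sym (abs-nonneg (inj₁ (0<Mᵢᵢ i))))))
                 (kaykobad-row i)

    module _ (y : Vector n) (My≡ν : ∀ i → (M ·ᵥ y) i ≡ ν i) (i₀ : Fin n) where
      private
        t : Vector n
        t j = y j * weight j ⁻¹

        tw≡y : ∀ j → t j * weight j ≡ y j
        tw≡y j = trans (*-assoc (y j) _ _) (trans (cong (y j *_) (*-inverseˡ (0<weight j))) (*-identityʳ (y j)))

        lo hi : Fin n
        lo = argmin t i₀ (allFin n)
        hi = argmax t i₀ (allFin n)

        s S : Carrier
        s = t lo
        S = t hi

        s≤t : ∀ j → s ≤ t j
        s≤t j = lookup (f[argmin]≤f[xs] i₀ (allFin n)) (∈-allFin j)

        t≤S : ∀ j → t j ≤ S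
        t≤S j = lookup (f[xs]≤f[argmax] i₀ (allFin n)) (∈-allFin j)

        P : Vector n
        P l = sumExcept l (λ j → M l j * weight j)

        off : Vector n
        off l = sumExcept l (λ j → M l j * y j)

        row : ∀ l → t l * ν l + off l ≡ ν l
        row l = begin
          t l * ν l + off l                ≡⟨ cong (λ x → t l * x + off l) (M·weight l) ⟨
          t l * (M l l * weight l) + off l ≡⟨ cong (_+ off l) (solve 3 (λ t m w → t :* (m :* w) := m :* (t :* w)) refl (t l) (M l l) (weight l)) ⟩
          M l l * (t l * weight l) + off l ≡⟨ cong (λ x → M l l * x + off l) (tw≡y l) ⟩
          M l l * y l + off l              ≡⟨ sum-except l (λ j → M l j * y j) ⟨
          (M ·ᵥ y) l                       ≡⟨ My≡ν l ⟩
          ν l                              ∎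
          where open ≡-Reasoning

        rescale : ∀ c l j → c * (M l j * weight j) ≡ M l j * (c * weight j)
        rescale c l j = solve 3 (λ c m w → c :* (m :* w) := m :* (c :* w)) refl c (M l j) (weight j)

        off-lower : ∀ l → s * P l ≤ off l
        off-lower l = subst (_≤ off l) (sym (sumExcept-*ˡ l s _)) (sumExcept-mono-≤ l λ j _ →
          subst₂ _≤_ (sym (rescale s l j)) (cong (M l j *_) (tw≡y j))
                 (*-monoˡ-≤ (0≤M l j) (*-monoʳ-≤ (inj₁ (0<weight j)) (s≤t j))))

        off-upper : ∀ l → off l ≤ S * P l
        off-upper l = subst (off l ≤_) (sym (sumExcept-*ˡ l S _)) (sumExcept-mono-≤ l λ j _ →
          subst₂ _≤_ (cong (M l j *_) (tw≡y j)) (sym (rescale S l j))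
                 (*-monoˡ-≤ (0≤M l j) (*-monoʳ-≤ (inj₁ (0<weight j)) (t≤S j))))

        0≤P : ∀ l → 0# ≤ P l
        0≤P l = sumExcept-nonneg l (λ j _ → 0≤-* (0≤M l j) (inj₁ (0<weight j)))

        S+s<1 : s < 0# → S + s < 1#
        S+s<1 s<0 = *-cancelʳ-< (0<ν hi) (begin-strict
          (S + s) * ν hi         ≡⟨ distribʳ (ν hi) S s ⟩
          S * ν hi + s * ν hi    <⟨ +-monoʳ-< (S * ν hi) (*-antiˡ-< s<0 (kaykobad-row hi)) ⟩
          S * ν hi + s * P hi    ≤⟨ +-monoʳ-≤ (S * ν hi) (off-lower hi) ⟩
          S * ν hi + off hi      ≡⟨ row hi ⟩
          ν hi                   ≡⟨ *-identityˡ (ν hi) ⟨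
          1# * ν hi              ∎)
          where open ≤-Reasoning

        lower-row : ν lo ≤ s * ν lo + S * P lo
        lower-row = begin
          ν lo                   ≡⟨ row lo ⟨
          s * ν lo + off lo      ≤⟨ +-monoʳ-≤ (s * ν lo) (off-upper lo) ⟩
          s * ν lo + S * P lo    ∎
          where open ≤-Reasoning

        1<s+S : 0# < S → 1# < s + S
        1<s+S 0<S = *-cancelʳ-< (0<ν lo) (begin-strict
          1# * ν lo              ≡⟨ *-identityˡ (ν lo) ⟩
          ν lo                   ≤⟨ lower-row ⟩
          s * ν lo + S * P lo    <⟨ +-monoʳ-< (s * ν lo) (*-monoˡ-< 0<S (kaykobad-row lo)) ⟩
          s * ν lo + S * ν lo    ≡⟨ distribʳ (ν lo) s S ⟨
          (s + S) * ν lo         ∎)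
          where open ≤-Reasoning

        1≤s : S ≤ 0# → 1# ≤ s
        1≤s S≤0 = *-cancelʳ-≤ (0<ν lo) (begin
          1# * ν lo              ≡⟨ *-identityˡ (ν lo) ⟩
          ν lo                   ≤⟨ lower-row ⟩
          s * ν lo + S * P lo    ≤⟨ +-monoʳ-≤ (s * ν lo) (*-antiˡ-≤ S≤0 (0≤P lo)) ⟩
          s * ν lo + S * 0#      ≡⟨ cong (s * ν lo +_) (zeroʳ S) ⟩
          s * ν lo + 0#          ≡⟨ +-identityʳ (s * ν lo) ⟩
          s * ν lo               ∎)
          where open ≤-Reasoning

        s≮0 : ¬ (s < 0#)
        s≮0 s<0 with compare 0# S
        ... | tri< 0<S _ _ = <-irrefl (<-trans (S+s<1 s<0) (subst (1# <_) (+-comm s S) (1<s+S 0<S)))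
        ... | tri≈ _ 0≡S _ = ≤⇒≯ (1≤s (inj₂ (sym 0≡S))) (<-trans s<0 0<1)
        ... | tri> _ _ S<0 = ≤⇒≯ (1≤s (inj₁ S<0)) (<-trans s<0 0<1)

      kaykobad-solution-nonneg : 0# ≤ y i₀
      kaykobad-solution-nonneg = subst (0# ≤_) (tw≡y i₀) (0≤-* (≤-trans (≮⇒≥ s≮0) (s≤t i₀)) (inj₁ (0<weight i₀)))

  kaykobad-inverse : ∀ {n} {M : Matrix n} {ν : Vector n} → KaykobadPair M ν →
                     Σ (Matrix n) λ N → IsInverse M N × (∀ i → 0# ≤ (N ·ᵥ ν) i)
  kaykobad-inverse {ν = ν} K =
    let N , N-inverse = weightedDominant⇒invertible (kaykobad⇒weightedDominant K)
    in  N , N-inverse , kaykobad-solution-nonneg K (N ·ᵥ ν) (inverse-·ᵥ N-inverse ν)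

module SignNormalisation (F : OrderedField) {n : ℕ} (B : Matrices.Matrix F n) (q : Matrices.Vector F n) where
  open Matrices F
  open OrderedFieldProperties F
  open SumProperties F
  open MatrixProperties F
  open KaykobadPairProperties F
  open ≡-Reasoning

  σ : Vector n
  σ i = sign (q i)

  B̄ᵀ : Matrix n
  B̄ᵀ = (B · diag σ) ᵀ

  q̄ : Vector n
  q̄ = diag σ ·ᵥ q

  sign-square : ∀ x → 0# < sign x * x → sign x * sign x ≡ 1#
  sign-square x 0<sign[x]x with compare 0# x
  ... | tri< _ _ _ = *-identityˡ 1#
  ... | tri≈ _ _ _ = ⊥-elim (<-irrefl (subst (0# <_) (zeroˡ x) 0<sign[x]x))
  ... | tri> _ _ _ = trans (-‿*-‿ 1# 1#) (*-identityˡ 1#)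

  module _ (0<q̄ : ∀ k → 0# < q̄ k) where
    σ²≡1 : ∀ k → σ k * σ k ≡ 1#
    σ²≡1 k = sign-square (q k) (subst (0# <_) (sum-diag* σ q k) (0<q̄ k))

    Bᵀ≡σB̄ᵀ : ∀ i k → (B ᵀ) i k ≡ σ i * B̄ᵀ i k
    Bᵀ≡σB̄ᵀ i k = begin
      B k i                   ≡⟨ *-identityʳ (B k i) ⟨
      B k i * 1#              ≡⟨ cong (B k i *_) (σ²≡1 i) ⟨
      B k i * (σ i * σ i)     ≡⟨ solve 2 (λ b s → b :* (s :* s) := s :* (b :* s)) refl (B k i) (σ i) ⟩
      σ i * (B k i * σ i)     ≡⟨ cong (σ i *_) (sum-*diag (B k) σ i) ⟨
      σ i * B̄ᵀ i k           ∎

  σ-scaled-·ᵥ : ∀ (N : Matrix n) i → ((λ i j → N i j * σ j) ·ᵥ q) i ≡ (N ·ᵥ q̄) i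
  σ-scaled-·ᵥ N i = sum-cong (λ k → trans (*-assoc (N i k) (σ k) (q k)) (cong (N i k *_) (sym (sum-diag* σ q k))))

  -σ-scaled-·ᵥ : ∀ (N : Matrix n) i → - ((λ i j → N i j * - σ j) ·ᵥ q) i ≡ (N ·ᵥ q̄) i
  -σ-scaled-·ᵥ N i = begin
    - sum (λ k → N i k * - σ k * q k)        ≡⟨ cong -_ (sum-cong (λ k → solve 3 (λ x s y → x :* :- s :* y := :- (x :* s :* y)) refl (N i k) (σ k) (q k))) ⟩
    - sum (λ k → - (N i k * σ k * q k))      ≡⟨ cong -_ (sum-‿ (λ k → N i k * σ k * q k)) ⟩
    - - sum (λ k → N i k * σ k * q k)        ≡⟨ -‿involutive _ ⟩
    ((λ i j → N i j * σ j) ·ᵥ q) i           ≡⟨ σ-scaled-·ᵥ N i ⟩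
    (N ·ᵥ q̄) i                               ∎

  refining : KaykobadPair B̄ᵀ q̄ → RefiningPair B q
  refining K@(_ , _ , 0<q̄ , _) =
    let N , N-inverse , 0≤Nq̄ = kaykobad-inverse K
    in  (λ i j → N i j * σ j) , inverse-rowScaled σ (σ²≡1 0<q̄) (Bᵀ≡σB̄ᵀ 0<q̄) N-inverse ,
        λ i → subst (0# ≤_) (sym (σ-scaled-·ᵥ N i)) (0≤Nq̄ i)

  relaxing : KaykobadPair (neg B̄ᵀ) q̄ → RelaxingPair B q
  relaxing K@(_ , _ , 0<q̄ , _) =
    let N , N-inverse , 0≤Nq̄ = kaykobad-inverse K
    in  (λ i j → N i j * - σ j) , inverse-rowScaled (λ k → - σ k) -σ²≡1 Bᵀ≡-σ[-B̄ᵀ] N-inverse ,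
        λ i → subst (0# ≤_) (sym (-σ-scaled-·ᵥ N i)) (0≤Nq̄ i)
    where
    -σ²≡1 : ∀ k → - σ k * - σ k ≡ 1#
    -σ²≡1 k = trans (-‿*-‿ (σ k) (σ k)) (σ²≡1 0<q̄ k)
    Bᵀ≡-σ[-B̄ᵀ] : ∀ i k → (B ᵀ) i k ≡ - σ i * - B̄ᵀ i k
    Bᵀ≡-σ[-B̄ᵀ] i k = trans (Bᵀ≡σB̄ᵀ 0<q̄ i k) (sym (-‿*-‿ (σ i) (B̄ᵀ i k)))

lemma3 : (F : OrderedField) → let open Matrices F in
    ∀ (n : ℕ) (B : Matrix n) (q : Vector n) →
      (KaykobadPair ((B · diag (λ i → sign (q i))) ᵀ) (diag (λ i → sign (q i)) ·ᵥ q) → RefiningPair B q)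
      × (KaykobadPair (neg ((B · diag (λ i → sign (q i))) ᵀ)) (diag (λ i → sign (q i)) ·ᵥ q) → RelaxingPair B q)
lemma3 F n B q = refining , relaxing
  where open SignNormalisation F B q
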